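{- Let $L$ be a $BL$-algebra and $F:L\to[0,1]$ a fuzzy set. Then $F$ is an $(\overline{\in},\overline{\in}\vee\overline{q})$-fuzzy positive implicative filter of $L$ if and only if for every $t\in(0.5,1]$ for which $U(F;t)=\{x\in L\mid F(x)\ge t\}$ is non-empty, $U(F;t)$ is a positive implicative filter of $L$.
   Context: A $BL$-algebra is an algebra $(L,\le,\wedge,\vee,\odot,\rightarrow,0,1)$ that is a bounded lattice (least element $0$, greatest element $1$) such that $(L,\odot,1)$ is a commutative monoid, $z\le x\rightarrow y$ iff $x\odot z\le y$, $x\wedge y=x\odot(x\rightarrow y)$, and $(x\rightarrow y)\vee(y\rightarrow x)=1$, for all $x,y,z\in L$. A filter of $L$ is a non-empty subset $A\subseteq L$ with $1\in A$ such that $x\in A$ and $x\rightarrow y\in A$ imply $y\in A$; it is positive implicative if $x\rightarrow(y\rightarrow z)\in A$ and $x\rightarrow y\in A$ imply $x\rightarrow z\in A$ for all $x,y,z$. For $x\in L$ and $t\in(0,1]$, the fuzzy point $U(x;t)$ is said to belong to $F$, written $U(x;t)\in F$, if $F(x)\ge t$, and to be quasi-coincident with $F$, written $U(x;t)\,q\,F$, if $F(x)+t>1$; $\overline{\in}$ and $\overline{q}$ denote the negations of these relations, and $U(x;t)\,\overline{\in}\vee\overline{q}\,F$ means $U(x;t)\,\overline{\in}\,F$ or $U(x;t)\,\overline{q}\,F$. A fuzzy set $F$ is an $(\overline{\in},\overline{\in}\vee\overline{q})$-fuzzy filter of $L$ if for all $t,r\in(0,1]$ and $x,y\in L$: (i)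 if $U(x\odot y;\min\{t,r\})\,\overline{\in}\,F$ then $U(x;t)\,\overline{\in}\vee\overline{q}\,F$ or $U(y;r)\,\overline{\in}\vee\overline{q}\,F$; (ii) if $x\le y$ and $U(y;r)\,\overline{\in}\,F$ then $U(x;r)\,\overline{\in}\vee\overline{q}\,F$. It is an $(\overline{\in},\overline{\in}\vee\overline{q})$-fuzzy positive implicative filter if moreover $\max\{F(x\rightarrow z),0.5\}\ge\min\{F(x\rightarrow(y\rightarrow z)),F(x\rightarrow y)\}$ for all $x,y,z\in L$. -}

module Defs where

open import Level using (0ℓ)
open import Data.Product using (Σ; ∃; _×_; _,_)
open import Data.Sum using (_⊎_)
open import Relation.Nullary using (¬_)
open import Relation.Binary.PropositionalEquality using (_≡_)
open import Relation.Binary.Structures using (IsStrictTotalOrder; IsPartialOrder)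
open import Relation.Binary.Definitions using (tri<; tri≈; tri>)
open import Algebra.Structures using (IsCommutativeRing)
open import Function.Bundles using (_⇔_)

-- The real numbers, axiomatised as a complete ordered field
-- (these axioms determine ℝ up to isomorphism; stdlib has no reals).

record RealNumbers : Set₁ where
  infixl 6 _+_
  infixl 7 _*_
  infix 4 _<_ _≤_
  field
    ℝ     : Set
    _+_   : ℝ → ℝ → ℝ
    _*_   : ℝ → ℝ → ℝ
    -_    : ℝ → ℝ
    0#    : ℝ
    1#    : ℝ
    _⁻¹   : ℝ → ℝ
    _<_   : ℝ → ℝ → Set
    isCommutativeRing : IsCommutativeRing _≡_ _+_ _*_ -_ 0# 1#
    ⁻¹-inverse : ∀ x → ¬ (x ≡ 0#) → x * (x ⁻¹) ≡ 1#
    0≢1   : ¬ (0# ≡ 1#)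
    isStrictTotalOrder : IsStrictTotalOrder _≡_ _<_
    +-mono-< : ∀ x y z → x < y → x + z < y + z
    *-pos    : ∀ x y → 0# < x → 0# < y → 0# < x * y

  _≤_ : ℝ → ℝ → Set
  x ≤ y = x < y ⊎ x ≡ y

  IsUpperBound : (ℝ → Set) → ℝ → Set
  IsUpperBound S b = ∀ x → S x → x ≤ b

  field
    complete : (S : ℝ → Set) → (∃ λ x → S x) → (∃ λ b → IsUpperBound S b) →
               ∃ λ s → IsUpperBound S s × (∀ b → IsUpperBound S b → s ≤ b)

  open IsStrictTotalOrder isStrictTotalOrder using (compare)

  min : ℝ → ℝ → ℝ
  min x y with compare x y
  ... | tri< _ _ _ = x
  ... | tri≈ _ _ _ = x
  ... | tri> _ _ _ = y

  max : ℝ → ℝ → ℝ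
  max x y with compare x y
  ... | tri< _ _ _ = y
  ... | tri≈ _ _ _ = y
  ... | tri> _ _ _ = x

  ½ : ℝ
  ½ = (1# + 1#) ⁻¹

record BLAlgebra : Set₁ where
  infixr 5 _⇒_
  infixl 7 _⊙_
  infixl 6 _∧_ _∨_
  infix 4 _≤_
  field
    Carrier : Set
    _≤_ : Carrier → Carrier → Set
    _∧_ _∨_ _⊙_ _⇒_ : Carrier → Carrier → Carrier
    𝟘 𝟙 : Carrier
    isPartialOrder : IsPartialOrder _≡_ _≤_
    ∧-lb₁ : ∀ x y → x ∧ y ≤ x
    ∧-lb₂ : ∀ x y → x ∧ y ≤ y
    ∧-glb : ∀ x y z → z ≤ x → z ≤ y → z ≤ x ∧ y
    ∨-ub₁ : ∀ x y → x ≤ x ∨ y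
    ∨-ub₂ : ∀ x y → y ≤ x ∨ y
    ∨-lub : ∀ x y z → x ≤ z → y ≤ z → x ∨ y ≤ z
    𝟘-least : ∀ x → 𝟘 ≤ x
    𝟙-greatest : ∀ x → x ≤ 𝟙
    ⊙-assoc : ∀ x y z → (x ⊙ y) ⊙ z ≡ x ⊙ (y ⊙ z)
    ⊙-comm  : ∀ x y → x ⊙ y ≡ y ⊙ x
    ⊙-identityʳ : ∀ x → x ⊙ 𝟙 ≡ x
    residuation : ∀ x y z → (z ≤ x ⇒ y → x ⊙ z ≤ y) × (x ⊙ z ≤ y → z ≤ x ⇒ y)
    divisibility : ∀ x y → x ∧ y ≡ x ⊙ (x ⇒ y)
    prelinearity : ∀ x y → (x ⇒ y) ∨ (y ⇒ x) ≡ 𝟙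

module _ (Rl : RealNumbers) (L : BLAlgebra) where
  open RealNumbers Rl
  open BLAlgebra L renaming (_≤_ to _≤L_)

  IsFilter : (Carrier → Set) → Set
  IsFilter A = (∃ λ x → A x) × A 𝟙 × (∀ x y → A x → A (x ⇒ y) → A y)

  IsPosImplFilter : (Carrier → Set) → Set
  IsPosImplFilter A = IsFilter A ×
    (∀ x y z → A (x ⇒ (y ⇒ z)) → A (x ⇒ y) → A (x ⇒ z))

  IsFuzzySet : (Carrier → ℝ) → Set
  IsFuzzySet F = ∀ x → (0# ≤ F x) × (F x ≤ 1#)

  -- fuzzy points U(x;t)
  _∈ᶠ_ : (Carrier × ℝ) → (Carrier → ℝ) → Set
  (x , t) ∈ᶠ F = t ≤ F x

  _qᶠ_ : (Carrier × ℝ) → (Carrier → ℝ) → Set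
  (x , t) qᶠ F = 1# < F x + t

  _∉̄ᶠ_ : (Carrier × ℝ) → (Carrier → ℝ) → Set
  p ∉̄ᶠ F = ¬ (p ∈ᶠ F)

  _∉̄∨q̄ᶠ_ : (Carrier × ℝ) → (Carrier → ℝ) → Set
  p ∉̄∨q̄ᶠ F = ¬ (p ∈ᶠ F) ⊎ ¬ (p qᶠ F)

  InUnit : ℝ → Set
  InUnit t = (0# < t) × (t ≤ 1#)

  IsFuzzyFilter : (Carrier → ℝ) → Set
  IsFuzzyFilter F =
    (∀ t r x y → InUnit t → InUnit r →
       (x ⊙ y , min t r) ∉̄ᶠ F → ((x , t) ∉̄∨q̄ᶠ F) ⊎ ((y , r) ∉̄∨q̄ᶠ F)) ×
    (∀ r x y → InUnit r → x ≤L y → (y , r) ∉̄ᶠ F → (x , r) ∉̄∨q̄ᶠ F)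

  IsFuzzyPosImplFilter : (Carrier → ℝ) → Set
  IsFuzzyPosImplFilter F = IsFuzzyFilter F ×
    (∀ x y z → min (F (x ⇒ (y ⇒ z))) (F (x ⇒ y)) ≤ max (F (x ⇒ z)) ½)

  U : (Carrier → ℝ) → ℝ → Carrier → Set
  U F t x = t ≤ F x

module Submission where

-- The whole argument rests on one observation about the threshold ½: for
-- t > ½, a fuzzy point U(x;t) belonging to F is automatically
-- quasi-coincident with F, and conversely U(x;r) ∈ F together with U(x;r) q F
-- forces F(x) > ½.  Hence the negative conditions defining an
-- (∈̄, ∈̄∨q̄)-fuzzy filter say exactly that the high level sets are upward
-- closed and closed under ⊙, i.e. are filters, and the inequality
-- max{F(x→z), ½} ≥ min{F(x→(y→z)), F(x→y)} says exactly that the high level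
-- sets obey the positive implicative rule.

open import Defs hiding (_∈ᶠ_; _qᶠ_; _∉̄ᶠ_; _∉̄∨q̄ᶠ_)
open import Level using (0ℓ)
open import Data.Product using (∃; _×_; _,_; proj₁; proj₂)
open import Data.Sum using (_⊎_; inj₁; inj₂; [_,_])
open import Data.Empty using (⊥-elim)
open import Function.Base using (_∘_)
open import Function.Bundles using (_⇔_; mk⇔; Equivalence)
open import Relation.Nullary using (¬_; yes; no)
open import Relation.Nullary.Decidable using (decidable-stable)
open import Relation.Binary.PropositionalEquality
  using (_≡_; refl; sym; trans; cong₂; subst; subst₂; isEquivalence; module ≡-Reasoning)
open import Relation.Binary.Structures using (IsStrictTotalOrder; IsPartialOrder)
open import Relation.Binary.Definitions using (Decidable; tri<; tri≈; tri>)
open import Algebra.Bundles using (CommutativeRing)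
open import Algebra.Structures using (IsCommutativeRing)
import Relation.Binary.Construct.StrictToNonStrict as StrictToNonStrict
import Algebra.Properties.Ring as RingProperties

module OrderedFieldFacts (Rl : RealNumbers) where
  open RealNumbers Rl
  open IsStrictTotalOrder isStrictTotalOrder
    using (compare; irrefl; asym; <-resp-≈; <-respʳ-≈; <-respˡ-≈)
    renaming (trans to <-trans)
  open IsStrictTotalOrder isStrictTotalOrder public using (_<?_)
  open IsCommutativeRing isCommutativeRing
    using (+-comm; +-identityˡ; -‿inverseʳ; distribʳ; *-identityˡ)
  private
    module NonStrict = StrictToNonStrict _≡_ _<_

    commutativeRing : CommutativeRing 0ℓ 0ℓ
    commutativeRing = record
      { Carrier = ℝ ; _≈_ = _≡_ ; _+_ = _+_ ; _*_ = _*_ ; -_ = -_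
      ; 0# = 0# ; 1# = 1# ; isCommutativeRing = isCommutativeRing }

    open RingProperties (CommutativeRing.ring commutativeRing) using (-1*x≈-x; -‿involutive)

  ≤-refl : ∀ {a} → a ≤ a
  ≤-refl = NonStrict.reflexive refl

  ≤-trans : ∀ {a b c} → a ≤ b → b ≤ c → a ≤ c
  ≤-trans = NonStrict.trans isEquivalence <-resp-≈ <-trans

  <-≤-trans : ∀ {a b c} → a < b → b ≤ c → a < c
  <-≤-trans = NonStrict.<-≤-trans <-trans <-respʳ-≈

  ≤-<-trans : ∀ {a b c} → a ≤ b → b < c → a < c
  ≤-<-trans = NonStrict.≤-<-trans sym <-trans <-respˡ-≈

  -- The order is decidable, which lets us argue by cases on the values of F.
  _≤?_ : Decidable _≤_
  _≤?_ = NonStrict.decidable′ compare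

  ≤⇒≯ : ∀ {a b} → a ≤ b → ¬ (b < a)
  ≤⇒≯ a≤b b<a = irrefl refl (≤-<-trans a≤b b<a)

  ≮⇒≥ : ∀ {a b} → ¬ (a < b) → b ≤ a
  ≮⇒≥ {a} {b} a≮b with compare a b
  ... | tri< a<b _ _ = ⊥-elim (a≮b a<b)
  ... | tri≈ _ a≡b _ = NonStrict.reflexive (sym a≡b)
  ... | tri> _ _ b<a = NonStrict.<⇒≤ b<a

  ≰⇒> : ∀ {a b} → ¬ (a ≤ b) → b < a
  ≰⇒> {a} {b} a≰b = decidable-stable (b <? a) (a≰b ∘ ≮⇒≥)

  +-monoˡ-≤ : ∀ c {a b} → a ≤ b → a + c ≤ b + c
  +-monoˡ-≤ c (inj₁ a<b) = inj₁ (+-mono-< _ _ c a<b)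
  +-monoˡ-≤ c (inj₂ refl) = ≤-refl

  +-mono-≤ : ∀ {a b c d} → a ≤ b → c ≤ d → a + c ≤ b + d
  +-mono-≤ {a} {b} {c} {d} a≤b c≤d =
    ≤-trans (+-monoˡ-≤ c a≤b) (subst₂ _≤_ (+-comm c b) (+-comm d b) (+-monoˡ-≤ b c≤d))

  +-mono-<₂ : ∀ {a b c d} → a < b → c < d → a + c < b + d
  +-mono-<₂ {a} {b} {c} {d} a<b c<d =
    <-trans (+-mono-< a b c a<b) (subst₂ _<_ (+-comm c b) (+-comm d b) (+-mono-< c d b c<d))

  -- In an ordered field 1 is positive: otherwise 0 < -1, whence 0 < (-1)(-1) = 1.
  0<1 : 0# < 1#
  0<1 with compare 0# 1#
  ... | tri< 0<1 _ _ = 0<1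
  ... | tri≈ _ 0≡1 _ = ⊥-elim (0≢1 0≡1)
  ... | tri> _ _ 1<0 = ⊥-elim (asym 1<0 (subst (0# <_) -1*-1≡1 (*-pos _ _ 0<-1 0<-1)))
    where
    0<-1 : 0# < - 1#
    0<-1 = subst₂ _<_ (-‿inverseʳ 1#) (+-identityˡ (- 1#)) (+-mono-< 1# 0# (- 1#) 1<0)
    -1*-1≡1 : - 1# * - 1# ≡ 1#
    -1*-1≡1 = trans (-1*x≈-x (- 1#)) (-‿involutive 1#)

  ½+½≡1 : ½ + ½ ≡ 1#
  ½+½≡1 = begin
    ½ + ½              ≡⟨ cong₂ _+_ (sym (*-identityˡ ½)) (sym (*-identityˡ ½)) ⟩
    1# * ½ + 1# * ½    ≡⟨ sym (distribʳ ½ 1# 1#) ⟩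
    (1# + 1#) * ½      ≡⟨ ⁻¹-inverse (1# + 1#) (λ 2≡0 → irrefl (sym 2≡0) 0<2) ⟩
    1#                 ∎
    where
    open ≡-Reasoning
    0<2 : 0# < 1# + 1#
    0<2 = <-trans 0<1 (subst (_< 1# + 1#) (+-identityˡ 1#) (+-mono-< 0# 1# 1# 0<1))

  above-½⇒q : ∀ {t a} → ½ < t → t ≤ a → 1# < a + t
  above-½⇒q {t} ½<t t≤a =
    subst (_< _) ½+½≡1 (<-≤-trans (+-mono-<₂ ½<t ½<t) (+-monoˡ-≤ t t≤a))

  q⇒above-½ : ∀ {r a} → r ≤ a → 1# < a + r → ½ < a
  q⇒above-½ {r} {a} r≤a 1<a+r = decidable-stable (½ <? a) λ ½≮a →
    let a≤½ = ≮⇒≥ ½≮a in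
    ≤⇒≯ (≤-trans (+-mono-≤ a≤½ (≤-trans r≤a a≤½)) (NonStrict.reflexive ½+½≡1)) 1<a+r

  above-½⇒pos : ∀ {t} → ½ < t → 0# < t
  above-½⇒pos {t} ½<t = decidable-stable (0# <? t) λ 0≮t →
    let t≤0 = ≮⇒≥ 0≮t in
    ≤⇒≯ (≤-trans (+-mono-≤ t≤0 t≤0) (NonStrict.reflexive (+-identityˡ 0#)))
        (<-trans 0<1 (above-½⇒q ½<t ≤-refl))

  min-elim : (P : ℝ → Set) → ∀ {a b} → P a → P b → P (min a b)
  min-elim P {a} {b} pa pb with compare a b
  ... | tri< _ _ _ = pa
  ... | tri≈ _ _ _ = pa
  ... | tri> _ _ _ = pb

  min-lb₁ : ∀ a b → min a b ≤ a
  min-lb₁ a b with compare a b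
  ... | tri< _ _ _ = ≤-refl
  ... | tri≈ _ _ _ = ≤-refl
  ... | tri> _ _ b<a = NonStrict.<⇒≤ b<a

  min-lb₂ : ∀ a b → min a b ≤ b
  min-lb₂ a b with compare a b
  ... | tri< a<b _ _ = NonStrict.<⇒≤ a<b
  ... | tri≈ _ a≡b _ = NonStrict.reflexive a≡b
  ... | tri> _ _ _ = ≤-refl

  min-idem : ∀ a → min a a ≡ a
  min-idem a = min-elim (_≡ a) refl refl

  min-mono-≤ : ∀ {a b c d} → a ≤ c → b ≤ d → min a b ≤ min c d
  min-mono-≤ {a} {b} a≤c b≤d =
    min-elim (min a b ≤_) (≤-trans (min-lb₁ a b) a≤c) (≤-trans (min-lb₂ a b) b≤d)

  max-ub₁ : ∀ a b → a ≤ max a b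
  max-ub₁ a b with compare a b
  ... | tri< a<b _ _ = NonStrict.<⇒≤ a<b
  ... | tri≈ _ a≡b _ = NonStrict.reflexive a≡b
  ... | tri> _ _ _ = ≤-refl

  max-ub₂ : ∀ a b → b ≤ max a b
  max-ub₂ a b with compare a b
  ... | tri< _ _ _ = ≤-refl
  ... | tri≈ _ _ _ = ≤-refl
  ... | tri> _ _ b<a = NonStrict.<⇒≤ b<a

  ≤-max-elim : ∀ {t a b} → b < t → t ≤ max a b → t ≤ a
  ≤-max-elim {t} {a} {b} b<t with compare a b
  ... | tri< _ _ _ = λ t≤b → ⊥-elim (≤⇒≯ t≤b b<t)
  ... | tri≈ _ _ _ = λ t≤b → ⊥-elim (≤⇒≯ t≤b b<t)
  ... | tri> _ _ _ = λ t≤a → t≤a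

module BLAlgebraFacts (L : BLAlgebra) where
  open BLAlgebra L
  open IsPartialOrder isPartialOrder using (antisym) renaming (refl to ≤-refl)

  ≤⇒⇒≡𝟙 : ∀ {x y} → x ≤ y → x ⇒ y ≡ 𝟙
  ≤⇒⇒≡𝟙 {x} {y} x≤y =
    antisym (𝟙-greatest _) (proj₂ (residuation x y 𝟙) (subst (_≤ y) (sym (⊙-identityʳ x)) x≤y))

  -- Modus ponens as an inequality: x ⊙ (x → y) = x ∧ y ≤ y.
  ⊙-⇒-≤ : ∀ x y → x ⊙ (x ⇒ y) ≤ y
  ⊙-⇒-≤ x y = subst (_≤ y) (divisibility x y) (∧-lb₂ x y)

  ≤-⇒-⊙ : ∀ x y → y ≤ x ⇒ (x ⊙ y)
  ≤-⇒-⊙ x y = proj₂ (residuation x (x ⊙ y) y) ≤-refl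

module FilterFacts (Rl : RealNumbers) (L : BLAlgebra) where
  open BLAlgebra L
  open BLAlgebraFacts L

  module _ {A : Carrier → Set} (isFilter : IsFilter Rl L A) where
    private
      A𝟙 : A 𝟙
      A𝟙 = proj₁ (proj₂ isFilter)
      mp : ∀ x y → A x → A (x ⇒ y) → A y
      mp = proj₂ (proj₂ isFilter)

    filter-upward : ∀ {x y} → x ≤ y → A x → A y
    filter-upward {x} {y} x≤y Ax = mp x y Ax (subst A (sym (≤⇒⇒≡𝟙 x≤y)) A𝟙)

    filter-⊙-closed : ∀ {x y} → A x → A y → A (x ⊙ y)
    filter-⊙-closed {x} {y} Ax Ay = mp x (x ⊙ y) Ax (filter-upward (≤-⇒-⊙ x y) Ay)

module HighLevels (Rl : RealNumbers) (L : BLAlgebra) (F : BLAlgebra.Carrier L → RealNumbers.ℝ Rl) where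
  open RealNumbers Rl
  open BLAlgebra L renaming (_≤_ to _≤L_)
  open OrderedFieldFacts Rl
  open BLAlgebraFacts L
  open FilterFacts Rl L

  private
    _∈ᶠ_ _qᶠ_ _∉̄ᶠ_ _∉̄∨q̄ᶠ_ : (Carrier × ℝ) → (Carrier → ℝ) → Set
    _∈ᶠ_ = Defs._∈ᶠ_ Rl L
    _qᶠ_ = Defs._qᶠ_ Rl L
    _∉̄ᶠ_ = Defs._∉̄ᶠ_ Rl L
    _∉̄∨q̄ᶠ_ = Defs._∉̄∨q̄ᶠ_ Rl L

  HighLevelsAreFilters : Set
  HighLevelsAreFilters =
    ∀ t → ½ < t → t ≤ 1# → (∃ λ x → U Rl L F t x) → IsFilter Rl L (U Rl L F t)

  HighLevelsArePosImpl : Set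
  HighLevelsArePosImpl =
    ∀ t → ½ < t → t ≤ 1# → ∀ x y z →
    U Rl L F t (x ⇒ (y ⇒ z)) → U Rl L F t (x ⇒ y) → U Rl L F t (x ⇒ z)

  PosImplInequality : Set
  PosImplInequality = ∀ x y z → min (F (x ⇒ (y ⇒ z))) (F (x ⇒ y)) ≤ max (F (x ⇒ z)) ½

  ∈∧q-or-∉̄∨q̄ : ∀ x t → ((x , t) ∈ᶠ F × (x , t) qᶠ F) ⊎ (x , t) ∉̄∨q̄ᶠ F
  ∈∧q-or-∉̄∨q̄ x t with t ≤? F x | 1# <? F x + t
  ... | no t≰Fx | _ = inj₂ (inj₁ t≰Fx)
  ... | yes _ | no ¬q = inj₂ (inj₂ ¬q)
  ... | yes t≤Fx | yes q = inj₁ (t≤Fx , q)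

  above-½-∈⇒¬∉̄∨q̄ : ∀ {x t} → ½ < t → t ≤ F x → ¬ ((x , t) ∉̄∨q̄ᶠ F)
  above-½-∈⇒¬∉̄∨q̄ ½<t t≤Fx = [ (λ t≰Fx → t≰Fx t≤Fx) , (λ ¬q → ¬q (above-½⇒q ½<t t≤Fx)) ]

  fuzzyFilter⇒highLevelsAreFilters : IsFuzzyFilter Rl L F → HighLevelsAreFilters
  fuzzyFilter⇒highLevelsAreFilters (⊙-condition , ≤-condition) t ½<t t≤1 (w , t≤Fw) =
    (w , t≤Fw) , upward (𝟙-greatest w) t≤Fw , λ x y t≤Fx t≤Fx⇒y →
      upward (⊙-⇒-≤ x y) (⊙-closed t≤Fx t≤Fx⇒y)
    where
    t∈unit : InUnit Rl L t
    t∈unit = above-½⇒pos ½<t , t≤1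
    upward : ∀ {x y} → x ≤L y → t ≤ F x → t ≤ F y
    upward {x} {y} x≤y t≤Fx = decidable-stable (t ≤? F y) λ t≰Fy →
      above-½-∈⇒¬∉̄∨q̄ ½<t t≤Fx (≤-condition t x y t∈unit x≤y t≰Fy)
    ⊙-closed : ∀ {x y} → t ≤ F x → t ≤ F y → t ≤ F (x ⊙ y)
    ⊙-closed {x} {y} t≤Fx t≤Fy = decidable-stable (t ≤? F (x ⊙ y)) λ t≰Fxy →
      [ above-½-∈⇒¬∉̄∨q̄ ½<t t≤Fx , above-½-∈⇒¬∉̄∨q̄ ½<t t≤Fy ]
        (⊙-condition t t x y t∈unit t∈unit (t≰Fxy ∘ subst (_≤ F (x ⊙ y)) (min-idem t)))

  module FromHighLevels (isFuzzy : IsFuzzySet Rl L F) (levels : HighLevelsAreFilters) where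
    levelFilter : ∀ {s w} → ½ < s → s ≤ F w → IsFilter Rl L (U Rl L F s)
    levelFilter {s} {w} ½<s s≤Fw = levels s ½<s (≤-trans s≤Fw (proj₂ (isFuzzy w))) (w , s≤Fw)

    monotone-above-½ : ∀ {x y} → ½ < F x → x ≤L y → F x ≤ F y
    monotone-above-½ ½<Fx x≤y = filter-upward (levelFilter ½<Fx ≤-refl) x≤y ≤-refl

    ⊙-above-½ : ∀ {x y} → ½ < F x → ½ < F y → min (F x) (F y) ≤ F (x ⊙ y)
    ⊙-above-½ {x} {y} ½<Fx ½<Fy =
      filter-⊙-closed (levelFilter (min-elim (½ <_) ½<Fx ½<Fy) (min-lb₁ (F x) (F y)))
        (min-lb₁ (F x) (F y)) (min-lb₂ (F x) (F y))

    -- A failure of either fuzzy filter condition would produce points whose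
    -- values exceed ½, where the two previous facts rule it out.
    isFuzzyFilter : IsFuzzyFilter Rl L F
    isFuzzyFilter = ⊙-condition , ≤-condition
      where
      ⊙-condition : ∀ t r x y → InUnit Rl L t → InUnit Rl L r →
        (x ⊙ y , min t r) ∉̄ᶠ F → ((x , t) ∉̄∨q̄ᶠ F) ⊎ ((y , r) ∉̄∨q̄ᶠ F)
      ⊙-condition t r x y _ _ tr∉Fxy with ∈∧q-or-∉̄∨q̄ x t | ∈∧q-or-∉̄∨q̄ y r
      ... | inj₂ x∉̄∨q̄ | _ = inj₁ x∉̄∨q̄
      ... | inj₁ _ | inj₂ y∉̄∨q̄ = inj₂ y∉̄∨q̄
      ... | inj₁ (t≤Fx , qx) | inj₁ (r≤Fy , qy) = ⊥-elim (tr∉Fxy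
        (≤-trans (min-mono-≤ t≤Fx r≤Fy) (⊙-above-½ (q⇒above-½ t≤Fx qx) (q⇒above-½ r≤Fy qy))))

      ≤-condition : ∀ r x y → InUnit Rl L r → x ≤L y → (y , r) ∉̄ᶠ F → (x , r) ∉̄∨q̄ᶠ F
      ≤-condition r x y _ x≤y r≰Fy with ∈∧q-or-∉̄∨q̄ x r
      ... | inj₂ x∉̄∨q̄ = x∉̄∨q̄
      ... | inj₁ (r≤Fx , qx) = ⊥-elim (r≰Fy (≤-trans r≤Fx (monotone-above-½ (q⇒above-½ r≤Fx qx) x≤y)))

  fuzzyFilter⇔highLevelsAreFilters : IsFuzzySet Rl L F → IsFuzzyFilter Rl L F ⇔ HighLevelsAreFilters
  fuzzyFilter⇔highLevelsAreFilters isFuzzy =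
    mk⇔ fuzzyFilter⇒highLevelsAreFilters (λ levels → FromHighLevels.isFuzzyFilter isFuzzy levels)

  posImplInequality⇔highLevelsArePosImpl : IsFuzzySet Rl L F → PosImplInequality ⇔ HighLevelsArePosImpl
  posImplInequality⇔highLevelsArePosImpl isFuzzy = mk⇔ inequality⇒levels levels⇒inequality
    where
    inequality⇒levels : PosImplInequality → HighLevelsArePosImpl
    inequality⇒levels inequality t ½<t _ x y z t≤F₁ t≤F₂ =
      ≤-max-elim ½<t (≤-trans (min-elim (t ≤_) t≤F₁ t≤F₂) (inequality x y z))

    levels⇒inequality : HighLevelsArePosImpl → PosImplInequality
    levels⇒inequality levels x y z with min (F (x ⇒ (y ⇒ z))) (F (x ⇒ y)) ≤? ½
    ... | yes m≤½ = ≤-trans m≤½ (max-ub₂ _ _)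
    ... | no m≰½ = ≤-trans (levels (min a b) (≰⇒> m≰½) m≤1 x y z (min-lb₁ a b) (min-lb₂ a b)) (max-ub₁ _ _)
      where
      a b : ℝ
      a = F (x ⇒ (y ⇒ z))
      b = F (x ⇒ y)
      m≤1 : min a b ≤ 1#
      m≤1 = ≤-trans (min-lb₁ a b) (proj₂ (isFuzzy _))

theorem3p2p4 : (Rl : RealNumbers) (L : BLAlgebra) →
    let open RealNumbers Rl
        open BLAlgebra L using (Carrier)
    in (F : Carrier → ℝ) → IsFuzzySet Rl L F →
       IsFuzzyPosImplFilter Rl L F ⇔
       (∀ t → ½ < t → t ≤ 1# → (∃ λ x → U Rl L F t x) → IsPosImplFilter Rl L (U Rl L F t))
theorem3p2p4 Rl L F isFuzzy = mk⇔
  (λ (isFuzzyFilter , inequality) t ½<t t≤1 nonempty →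
     filters.to isFuzzyFilter t ½<t t≤1 nonempty , posImpl.to inequality t ½<t t≤1)
  (λ levels →
     filters.from (λ t ½<t t≤1 nonempty → proj₁ (levels t ½<t t≤1 nonempty)) ,
     posImpl.from (λ t ½<t t≤1 x y z t≤F₁ → proj₂ (levels t ½<t t≤1 (_ , t≤F₁)) x y z t≤F₁))
  where
  open HighLevels Rl L F
  module filters = Equivalence (fuzzyFilter⇔highLevelsAreFilters isFuzzy)
  module posImpl = Equivalence (posImplInequality⇔highLevelsArePosImpl isFuzzy)
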